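{- Let $P$ be a finite graded poset of rank $N$, i.e.\ every maximal chain in $P$ has length $N$ (consists of $N+1$ elements). Then for every $k \in \mathbb{N}$ the poset $P[k]$ is graded of rank $kN$, and the rank function $\rho$ of $P[k]$ is given by \[ \rho(x_1 \leq x_2 \leq \dotsb \leq x_k) = \sum_{i=1}^k \rho(x_i), \] where on the right $\rho$ denotes the rank function of $P$.
   Context: For a poset $(P,\leq)$ and $k\in\mathbb{N}$, the poset of $k$-chains is $P[k] = \{(x_1 \leq x_2 \leq \dotsb \leq x_k) \mid x_i \in P\}$ (multichains, repetitions allowed), ordered by $(x_1 \leq \dotsb \leq x_k) \leq_k (x'_1 \leq \dotsb \leq x'_k)$ iff $x_i \leq x'_i$ for all $i$. Rank convention for a graded poset: $\rho(x)=0$ for every minimal element $x$, and $\rho(x)=\rho(y)+1$ whenever $x$ covers $y$. -}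

module Defs where

open import Data.Nat using (ℕ; suc)
open import Data.Bool using (Bool; T)
open import Data.Fin using (Fin)
open import Data.List using (List; length)
open import Data.List.Membership.Propositional using (_∈_)
import Data.List.Relation.Unary.Linked as L
open import Data.Vec using (Vec; map; sum)
import Data.Vec.Relation.Unary.Linked as VL
open import Data.Vec.Relation.Binary.Pointwise.Inductive using (Pointwise)
open import Data.Product using (Σ; _×_; proj₁)
open import Relation.Binary.PropositionalEquality using (_≡_; _≢_)
open import Relation.Nullary using (¬_)

module _ {A : Set} (_≤_ : A → A → Set) where

  _<_ : A → A → Set
  x < y = (x ≤ y) × (x ≢ y)

  -- a chain, written as a strictly increasing list x₀ < x₁ < … < xₘ
  -- (by transitivity every two of its elements are comparable)
  IsChain : List A → Set
  IsChain = L.Linked _<_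

  IsMaximalChain : List A → Set
  IsMaximalChain C =
    IsChain C ×
    ((D : List A) → IsChain D → (∀ x → x ∈ C → x ∈ D) → ∀ x → x ∈ D → x ∈ C)

  IsGradedOfRank : ℕ → Set
  IsGradedOfRank N = (C : List A) → IsMaximalChain C → length C ≡ suc N

  IsMinimal : A → Set
  IsMinimal x = ∀ y → y ≤ x → y ≡ x

  _⋖_ : A → A → Set
  y ⋖ x = (y < x) × (∀ z → y < z → ¬ (z < x))

  IsRankFunction : (A → ℕ) → Set
  IsRankFunction ρ =
    (∀ x → IsMinimal x → ρ x ≡ 0) × (∀ x y → y ⋖ x → ρ x ≡ suc (ρ y))

module _ {n : ℕ} (le : Fin n → Fin n → Bool) where

  _≤P_ : Fin n → Fin n → Set
  x ≤P y = T (le x y)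

  -- the poset P[k] of k-multichains x₁ ≤ x₂ ≤ … ≤ xₖ
  Chains : ℕ → Set
  Chains k = Σ (Vec (Fin n) k) (VL.Linked _≤P_)

  ≤ₖ : (k : ℕ) → Chains k → Chains k → Set
  ≤ₖ k x y = Pointwise _≤P_ (proj₁ x) (proj₁ y)

  sumRank : (ρ : Fin n → ℕ) → (k : ℕ) → Chains k → ℕ
  sumRank ρ k x = sum (map ρ (proj₁ x))

module Submission where

-- The proof rests on the characterisation of maximal chains in a poset with
-- decidable equality as the saturated chains (every step a cover) running
-- from a minimal to a maximal element (PosetFacts). Consequently a poset is
-- graded of rank M as soon as it is nonempty and carries a rank function that
-- takes the value M on all maximal elements.
--
-- For P itself (FinitePoset), finiteness makes strict order well-founded in
-- both directions, so every element x lies on a saturated chain from a minimal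
-- to a maximal element; the number of steps below x is a rank function ρ, and
-- gradedness forces every rank function to equal N on maximal elements.
--
-- For P[k] (Multichains), a cover of multichains moves exactly one entry up by
-- a cover of P, minimal (maximal) multichains are constant at a minimal
-- (maximal) element of P, so Σᵢ ρ(xᵢ) is a rank function of P[k] that equals
-- kN on maximal multichains. The theorem follows from the criterion above.

open import Defs
open import Data.Nat using (ℕ; zero; suc; _+_; _*_)
open import Data.Nat.Properties using (+-suc; +-identityʳ; suc-injective; +-cancelʳ-≡; *-zeroʳ)
open import Data.Bool using (Bool)
open import Data.Bool.Properties using (T?; T-irrelevant)
open import Data.Fin using (Fin) renaming (zero to fzero)
open import Data.Fin.Properties using (any?; _≟_)
open import Data.Fin.Induction using (po-wellFounded; po-noetherian)
open import Data.Product using (Σ; _×_; _,_; proj₁; proj₂)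
open import Data.Sum using (_⊎_; inj₁; inj₂)
open import Data.Empty using (⊥; ⊥-elim)
open import Data.List using (List; []; _∷_; _++_; [_]; length)
open import Data.List.Properties using (++-assoc; length-++)
open import Data.List.Membership.Propositional using (_∈_)
open import Data.List.Membership.Propositional.Properties using (∈-++⁺ˡ; ∈-++⁺ʳ; ∈-++⁻)
open import Data.List.Relation.Unary.Any using (here; there)
open import Data.List.Relation.Unary.All as All using (All; []; _∷_)
open import Data.List.Relation.Unary.All.Properties using (++⁺)
open import Data.List.Relation.Unary.AllPairs using (AllPairs; []; _∷_)
open import Data.List.Relation.Unary.Linked as Linked using ([]; [-]; _∷_)
open import Data.List.Relation.Unary.Linked.Properties using (Linked⇒All; Linked⇒AllPairs)
open import Data.Vec as V using (Vec; []; _∷_; replicate; map; sum)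
open import Data.Vec.Properties using (≡-dec)
import Data.Vec.Relation.Unary.Linked as VL
open VL using ([]; [-]; _∷_)
open import Data.Vec.Relation.Binary.Pointwise.Inductive as Pw using (Pointwise; []; _∷_)
open import Function using (flip)
open import Induction.WellFounded using (Acc; acc)
open import Relation.Nullary using (¬_; yes; no; Dec; ¬?)
open import Relation.Nullary.Decidable using (_×-dec_; map′)
open import Relation.Binary.Definitions using (DecidableEquality)
open import Relation.Binary.Structures using (IsPartialOrder)
open import Relation.Binary.PropositionalEquality
  using (_≡_; _≢_; refl; sym; trans; cong; cong₂; subst; isEquivalence; module ≡-Reasoning)

IsMaximal : {A : Set} → (A → A → Set) → A → Set
IsMaximal _≤_ x = ∀ y → x ≤ y → y ≡ x

module PosetFacts {A : Set} {_≤_ : A → A → Set}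
                  (isPO : IsPartialOrder _≡_ _≤_) (_≟_ : DecidableEquality A) where
  open IsPartialOrder isPO using (reflexive; antisym) renaming (trans to ≤-trans)

  ≤-refl : ∀ {x} → x ≤ x
  ≤-refl = reflexive refl

  _⊏_ : A → A → Set
  _⊏_ = _<_ _≤_

  _⋖ₚ_ : A → A → Set
  _⋖ₚ_ = _⋖_ _≤_

  ⊏-irrefl : ∀ {x} → ¬ (x ⊏ x)
  ⊏-irrefl (_ , x≢x) = x≢x refl

  ⊏-trans : ∀ {x y z} → x ⊏ y → y ⊏ z → x ⊏ z
  ⊏-trans (x≤y , _) (y≤z , y≢z) = ≤-trans x≤y y≤z , λ { refl → y≢z (antisym y≤z x≤y) }

  minimal-if : ∀ {x} → (∀ y → ¬ (y ⊏ x)) → IsMinimal _≤_ x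
  minimal-if {x} none y y≤x with y ≟ x
  ... | yes y≡x = y≡x
  ... | no  y≢x = ⊥-elim (none y (y≤x , y≢x))

  maximal-if : ∀ {x} → (∀ y → ¬ (x ⊏ y)) → IsMaximal _≤_ x
  maximal-if {x} none y x≤y with y ≟ x
  ... | yes y≡x = y≡x
  ... | no  y≢x = ⊥-elim (none y (x≤y , λ x≡y → y≢x (sym x≡y)))

  -- Saturated a L c: a saturated chain a ⋖ b₁ ⋖ … ⋖ bₘ = c, where L = b₁ … bₘ.
  data Saturated : A → List A → A → Set where
    []  : ∀ {a} → Saturated a [] a
    _∷_ : ∀ {a b c L} → a ⋖ₚ b → Saturated b L c → Saturated a (b ∷ L) c

  _++ˢ_ : ∀ {a b c L M} → Saturated a L b → Saturated b M c → Saturated a (L ++ M) c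
  []      ++ˢ s = s
  (c ∷ r) ++ˢ s = c ∷ (r ++ˢ s)

  saturated⇒chain : ∀ {a L c} → Saturated a L c → IsChain _≤_ (a ∷ L)
  saturated⇒chain []           = [-]
  saturated⇒chain (a⋖b ∷ rest) = proj₁ a⋖b ∷ saturated⇒chain rest

  rank-along : (r : A → ℕ) → (∀ x y → y ⋖ₚ x → r x ≡ suc (r y)) →
               ∀ {a L c} → Saturated a L c → r c ≡ length L + r a
  rank-along r r-cov []                  = refl
  rank-along r r-cov {a} {c = c} (_∷_ {b = b} {L = L} a⋖b rest) = begin
    r c                ≡⟨ rank-along r r-cov rest ⟩
    length L + r b     ≡⟨ cong (length L +_) (r-cov b a a⋖b) ⟩
    length L + suc (r a) ≡⟨ +-suc (length L) (r a) ⟩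
    suc (length L + r a) ∎
    where open ≡-Reasoning

  comparable : ∀ {D x y} → IsChain _≤_ D → x ∈ D → y ∈ D → (x ≤ y) ⊎ (y ≤ x)
  comparable chain = go (Linked⇒AllPairs ⊏-trans chain)
    where
    go : ∀ {D x y} → AllPairs _⊏_ D → x ∈ D → y ∈ D → (x ≤ y) ⊎ (y ≤ x)
    go (_ ∷ _)   (here refl) (here refl) = inj₁ ≤-refl
    go (x⊏ ∷ _)  (here refl) (there q)   = inj₁ (proj₁ (All.lookup x⊏ q))
    go (y⊏ ∷ _)  (there p)   (here refl) = inj₂ (proj₁ (All.lookup y⊏ p))
    go (_ ∷ ps)  (there p)   (there q)   = go ps p q

  insert-chain : ∀ pre {z post} → IsChain _≤_ (pre ++ post) →
                 All (_⊏ z) pre → All (z ⊏_) post → IsChain _≤_ (pre ++ z ∷ post)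
  insert-chain []            {post = []}    _             _           _         = [-]
  insert-chain []            {post = _ ∷ _} chain         _           (z⊏p ∷ _) = z⊏p ∷ chain
  insert-chain (p ∷ [])      chain          (p⊏z ∷ [])  above =
    p⊏z ∷ insert-chain [] (Linked.tail chain) [] above
  insert-chain (p ∷ q ∷ pre) (p⊏q ∷ chain)  (_ ∷ below) above =
    p⊏q ∷ insert-chain (q ∷ pre) chain below above

  ⊆-insert : ∀ pre {z post} (x : A) → x ∈ pre ++ post → x ∈ pre ++ z ∷ post
  ⊆-insert pre x x∈ with ∈-++⁻ pre x∈
  ... | inj₁ x∈pre  = ∈-++⁺ˡ x∈pre
  ... | inj₂ x∈post = ∈-++⁺ʳ pre (there x∈post)

  no-gap : ∀ pre post {z} → IsMaximalChain _≤_ (pre ++ post) →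
           All (_⊏ z) pre → All (z ⊏_) post → ⊥
  no-gap pre post {z} (chain , maximal) below above =
    z∉ (maximal (pre ++ z ∷ post) (insert-chain pre chain below above)
                (⊆-insert pre) z (∈-++⁺ʳ pre (here refl)))
    where
    z∉ : ¬ (z ∈ pre ++ post)
    z∉ z∈ with ∈-++⁻ pre z∈
    ... | inj₁ z∈pre  = ⊏-irrefl (All.lookup below z∈pre)
    ... | inj₂ z∈post = ⊏-irrefl (All.lookup above z∈post)

  below-extend : ∀ {pre a z} → All (_⊏ a) pre → a ⊏ z → All (_⊏ z) (pre ++ [ a ])
  below-extend below a⊏z = ++⁺ (All.map (λ x⊏a → ⊏-trans x⊏a a⊏z) below) (a⊏z ∷ [])

  regroup : ∀ pre a L → IsMaximalChain _≤_ (pre ++ a ∷ L) → IsMaximalChain _≤_ ((pre ++ [ a ]) ++ L)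
  regroup pre a L = subst (IsMaximalChain _≤_) (sym (++-assoc pre [ a ] L))

  -- the final part a ∷ L of a maximal chain is saturated and ends at a maximal
  -- element: consecutive elements are covers and the last one is maximal, as
  -- anything strictly between (or above) them would fill a gap
  saturated-from : ∀ pre a L → IsMaximalChain _≤_ (pre ++ a ∷ L) → All (_⊏ a) pre →
                   IsChain _≤_ (a ∷ L) → Σ A λ c → Saturated a L c × IsMaximal _≤_ c
  saturated-from pre a [] maxC below _ =
    a , [] , maximal-if λ y a⊏y →
      no-gap (pre ++ [ a ]) [] (regroup pre a [] maxC) (below-extend below a⊏y) []
  saturated-from pre a (b ∷ L) maxC below (a⊏b ∷ chain) =
    let (c , sat , c-max) = saturated-from (pre ++ [ a ]) b L maxC′ (below-extend below a⊏b) chain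
    in  c , a⋖b ∷ sat , c-max
    where
    maxC′ : IsMaximalChain _≤_ ((pre ++ [ a ]) ++ b ∷ L)
    maxC′ = regroup pre a (b ∷ L) maxC
    a⋖b : a ⋖ₚ b
    a⋖b = a⊏b , λ z a⊏z z⊏b →
      no-gap (pre ++ [ a ]) (b ∷ L) maxC′ (below-extend below a⊏z) (Linked⇒All ⊏-trans z⊏b chain)

  maximalChain⇒saturated : ∀ {a L} → IsMaximalChain _≤_ (a ∷ L) →
                           IsMinimal _≤_ a × Σ A λ c → Saturated a L c × IsMaximal _≤_ c
  maximalChain⇒saturated {a} {L} maxC =
    minimal-if (λ y y⊏a → no-gap [] (a ∷ L) maxC [] (Linked⇒All ⊏-trans y⊏a (proj₁ maxC))) ,
    saturated-from [] a L maxC [] (proj₁ maxC)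

  on-saturated : ∀ {a L c z} → Saturated a L c → IsMaximal _≤_ c → a ≤ z →
                 All (λ x → (z ≤ x) ⊎ (x ≤ z)) L → z ∈ a ∷ L
  on-saturated []            c-max a≤z []               = here (c-max _ a≤z)
  on-saturated (_ ∷ rest)    c-max _   (inj₂ b≤z ∷ cmp) = there (on-saturated rest c-max b≤z cmp)
  on-saturated {a} {z = z} (_∷_ {b = b} a⋖b _) _ a≤z (inj₁ z≤b ∷ _) with z ≟ b | a ≟ z
  ... | yes z≡b | _       = there (here z≡b)
  ... | no _    | yes a≡z = here (sym a≡z)
  ... | no z≢b  | no a≢z  = ⊥-elim (proj₂ a⋖b z (a≤z , a≢z) (z≤b , z≢b))

  saturated⇒maximalChain : ∀ {a L c} → IsMinimal _≤_ a → Saturated a L c → IsMaximal _≤_ c →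
                           IsMaximalChain _≤_ (a ∷ L)
  saturated⇒maximalChain {a} {L} a-min sat c-max = saturated⇒chain sat , on-chain
    where
    on-chain : (D : List A) → IsChain _≤_ D → (∀ x → x ∈ a ∷ L → x ∈ D) → ∀ z → z ∈ D → z ∈ a ∷ L
    on-chain D chain a∷L⊆D z z∈D with comparable chain z∈D (a∷L⊆D a (here refl))
    ... | inj₁ z≤a = here (a-min z z≤a)
    ... | inj₂ a≤z = on-saturated sat c-max a≤z
                       (All.tabulate λ x∈L → comparable chain z∈D (a∷L⊆D _ (there x∈L)))

  no-empty-maximalChain : A → ¬ IsMaximalChain _≤_ []
  no-empty-maximalChain e (_ , maximal) with maximal [ e ] [-] (λ _ ()) e (here refl)
  ... | ()

  saturated-length : ∀ {N a L c} → IsGradedOfRank _≤_ N →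
                     IsMinimal _≤_ a → Saturated a L c → IsMaximal _≤_ c → length L ≡ N
  saturated-length graded a-min sat c-max =
    suc-injective (graded _ (saturated⇒maximalChain a-min sat c-max))

  graded-by-rank : A → (r : A → ℕ) → IsRankFunction _≤_ r →
                   ∀ M → (∀ c → IsMaximal _≤_ c → r c ≡ M) → IsGradedOfRank _≤_ M
  graded-by-rank e r _ M _ [] maxC = ⊥-elim (no-empty-maximalChain e maxC)
  graded-by-rank e r (r-min , r-cov) M r-max (a ∷ L) maxC
    with maximalChain⇒saturated maxC
  ... | a-min , c , sat , c-max = cong suc (begin
    length L       ≡⟨ sym (+-identityʳ (length L)) ⟩
    length L + 0   ≡⟨ cong (length L +_) (sym (r-min a a-min)) ⟩
    length L + r a ≡⟨ sym (rank-along r r-cov sat) ⟩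
    r c            ≡⟨ r-max c c-max ⟩
    M              ∎)
    where open ≡-Reasoning

module FinitePoset {n : ℕ} (le : Fin n → Fin n → Bool) (isPO : IsPartialOrder _≡_ (_≤P_ le)) where
  open PosetFacts isPO _≟_

  _⊏?_ : ∀ x y → Dec (x ⊏ y)
  x ⊏? y = T? (le x y) ×-dec ¬? (x ≟ y)

  cover-below : ∀ {x y} → y ⊏ x → Σ (Fin n) (_⋖ₚ x)
  cover-below {x} {y} y⊏x = go y (po-noetherian isPO y) y⊏x
    where
    go : ∀ y → Acc (flip _⊏_) y → y ⊏ x → Σ (Fin n) (_⋖ₚ x)
    go y (acc rec) y⊏x with any? (λ z → (y ⊏? z) ×-dec (z ⊏? x))
    ... | yes (z , y⊏z , z⊏x) = go z (rec y⊏z) z⊏x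
    ... | no none             = y , y⊏x , λ z y⊏z z⊏x → none (z , y⊏z , z⊏x)

  cover-above : ∀ {x y} → x ⊏ y → Σ (Fin n) (x ⋖ₚ_)
  cover-above {x} {y} x⊏y = go y (po-wellFounded isPO y) x⊏y
    where
    go : ∀ y → Acc _⊏_ y → x ⊏ y → Σ (Fin n) (x ⋖ₚ_)
    go y (acc rec) x⊏y with any? (λ z → (x ⊏? z) ×-dec (z ⊏? y))
    ... | yes (z , x⊏z , z⊏y) = go z (rec z⊏y) x⊏z
    ... | no none             = y , x⊏y , λ z x⊏z z⊏y → none (z , x⊏z , z⊏y)

  record DownChain (x : Fin n) : Set where
    field
      bottom         : Fin n
      steps          : List (Fin n)
      bottom-minimal : IsMinimal (_≤P_ le) bottom
      saturated      : Saturated bottom steps x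

  record UpChain (x : Fin n) : Set where
    field
      top         : Fin n
      steps       : List (Fin n)
      saturated   : Saturated x steps top
      top-maximal : IsMaximal (_≤P_ le) top

  down-chain : ∀ x → DownChain x
  down-chain x = go x (po-wellFounded isPO x)
    where
    go : ∀ x → Acc _⊏_ x → DownChain x
    go x (acc rec) with any? (_⊏? x)
    ... | no none = record { bottom = x ; steps = [] ; saturated = []
                           ; bottom-minimal = minimal-if λ y y⊏x → none (y , y⊏x) }
    ... | yes (_ , y⊏x) with cover-below y⊏x
    ... | w , w⋖x = record { DownChain below ; steps = steps ++ [ x ]
                                             ; saturated = saturated ++ˢ (w⋖x ∷ []) }
      where
      below = go w (rec (proj₁ w⋖x))
      open DownChain below

  up-chain : ∀ x → UpChain x
  up-chain x = go x (po-noetherian isPO x)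
    where
    go : ∀ x → Acc (flip _⊏_) x → UpChain x
    go x (acc rec) with any? (x ⊏?_)
    ... | no none = record { top = x ; steps = [] ; saturated = []
                           ; top-maximal = maximal-if λ y x⊏y → none (y , x⊏y) }
    ... | yes (_ , x⊏y) with cover-above x⊏y
    ... | w , x⋖w = record { UpChain above ; steps = w ∷ steps ; saturated = x⋖w ∷ saturated }
      where
      above = go w (rec (proj₁ x⋖w))
      open UpChain above

  module Graded (N : ℕ) (graded : IsGradedOfRank (_≤P_ le) N) where

    ρ : Fin n → ℕ
    ρ x = length (DownChain.steps (down-chain x))

    up-length : Fin n → ℕ
    up-length x = length (UpChain.steps (up-chain x))

    -- joining the down- and up-chain of x gives a maximal chain
    ρ-through : ∀ x → ρ x + up-length x ≡ N
    ρ-through x = trans (sym (length-++ D.steps))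
                    (saturated-length graded D.bottom-minimal (D.saturated ++ˢ U.saturated) U.top-maximal)
      where
      module D = DownChain (down-chain x)
      module U = UpChain (up-chain x)

    -- for minimal x the up-chain alone is maximal, so no steps lie below x
    ρ-minimal : ∀ x → IsMinimal (_≤P_ le) x → ρ x ≡ 0
    ρ-minimal x x-min = +-cancelʳ-≡ N (ρ x) 0 (begin
      ρ x + N           ≡⟨ cong (ρ x +_) (sym up-maximal) ⟩
      ρ x + up-length x ≡⟨ ρ-through x ⟩
      N                 ∎)
      where
      open ≡-Reasoning
      module U = UpChain (up-chain x)
      up-maximal : up-length x ≡ N
      up-maximal = saturated-length graded x-min U.saturated U.top-maximal

    -- for y ⋖ x the down-chain of y, then x, then the up-chain of x is maximal
    ρ-cover : ∀ x y → y ⋖ₚ x → ρ x ≡ suc (ρ y)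
    ρ-cover x y y⋖x = +-cancelʳ-≡ (up-length x) (ρ x) (suc (ρ y)) (begin
      ρ x + up-length x       ≡⟨ ρ-through x ⟩
      N                       ≡⟨ sym joined-maximal ⟩
      length (D.steps ++ x ∷ U.steps) ≡⟨ length-++ D.steps ⟩
      ρ y + suc (up-length x) ≡⟨ +-suc (ρ y) (up-length x) ⟩
      suc (ρ y) + up-length x ∎)
      where
      open ≡-Reasoning
      module D = DownChain (down-chain y)
      module U = UpChain (up-chain x)
      joined-maximal : length (D.steps ++ x ∷ U.steps) ≡ N
      joined-maximal =
        saturated-length graded D.bottom-minimal (D.saturated ++ˢ (y⋖x ∷ U.saturated)) U.top-maximal

    ρ-isRankFunction : IsRankFunction (_≤P_ le) ρ
    ρ-isRankFunction = ρ-minimal , ρ-cover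

    rank-maximal : ∀ r → IsRankFunction (_≤P_ le) r → ∀ x → IsMaximal (_≤P_ le) x → r x ≡ N
    rank-maximal r (r-min , r-cov) x x-max = begin
      r x                ≡⟨ rank-along r r-cov D.saturated ⟩
      length D.steps + r D.bottom ≡⟨ cong (length D.steps +_) (r-min D.bottom D.bottom-minimal) ⟩
      length D.steps + 0 ≡⟨ +-identityʳ (length D.steps) ⟩
      length D.steps     ≡⟨ saturated-length graded D.bottom-minimal D.saturated x-max ⟩
      N                  ∎
      where
      open ≡-Reasoning
      module D = DownChain (down-chain x)

module Multichains {n : ℕ} (le : Fin n → Fin n → Bool) (isPO : IsPartialOrder _≡_ (_≤P_ le)) where
  open IsPartialOrder isPO using (antisym) renaming (trans to ≤-trans)
  open PosetFacts isPO _≟_ using (≤-refl; _⋖ₚ_)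

  private
    _≤_ : Fin n → Fin n → Set
    _≤_ = _≤P_ le

  _⊏ₖ_ : ∀ {k} → Chains le k → Chains le k → Set
  _⊏ₖ_ {k} = _<_ (≤ₖ le k)

  _⋖ₖ_ : ∀ {k} → Chains le k → Chains le k → Set
  _⋖ₖ_ {k} = _⋖_ (≤ₖ le k)

  chain-≡ : ∀ {k} {x y : Chains le k} → proj₁ x ≡ proj₁ y → x ≡ y
  chain-≡ {x = v , p} {y = .v , q} refl = cong (v ,_) (VL.irrelevant (λ s t → T-irrelevant s t) p q)

  _≟ᵥ_ : ∀ {k} → DecidableEquality (Vec (Fin n) k)
  _≟ᵥ_ = ≡-dec _≟_

  _≟ₖ_ : ∀ {k} → DecidableEquality (Chains le k)
  x ≟ₖ y = map′ chain-≡ (cong proj₁) (proj₁ x ≟ᵥ proj₁ y)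

  ⊏ₖ-intro : ∀ {k} {x y : Chains le k} → ≤ₖ le k x y → proj₁ x ≢ proj₁ y → x ⊏ₖ y
  ⊏ₖ-intro x≤y x≢y = x≤y , λ x≡y → x≢y (cong proj₁ x≡y)

  pointwise-antisym : ∀ {k} {u v : Vec (Fin n) k} → Pointwise _≤_ u v → Pointwise _≤_ v u → u ≡ v
  pointwise-antisym []           []           = refl
  pointwise-antisym (a≤b ∷ u≤v) (b≤a ∷ v≤u) = cong₂ _∷_ (antisym a≤b b≤a) (pointwise-antisym u≤v v≤u)

  isPartialOrderₖ : ∀ k → IsPartialOrder _≡_ (≤ₖ le k)
  isPartialOrderₖ k = record
    { isPreorder = record
      { isEquivalence = isEquivalence
      ; reflexive     = λ { refl → Pw.refl ≤-refl }
      ; trans         = Pw.trans ≤-trans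
      }
    ; antisym = λ x≤y y≤x → chain-≡ (pointwise-antisym x≤y y≤x)
    }

  lower-head : ∀ {k z a} {vs : Vec (Fin n) k} → z ≤ a → VL.Linked _≤_ (a ∷ vs) → VL.Linked _≤_ (z ∷ vs)
  lower-head {vs = []}    _   _         = [-]
  lower-head {vs = _ ∷ _} z≤a (a≤ ∷ l) = ≤-trans z≤a a≤ ∷ l

  raise-tail : ∀ {k b} {ys zs : Vec (Fin n) k} →
               VL.Linked _≤_ (b ∷ ys) → Pointwise _≤_ ys zs → VL.Linked _≤_ zs → VL.Linked _≤_ (b ∷ zs)
  raise-tail {ys = []}    {[]}    _          _           _  = [-]
  raise-tail {ys = _ ∷ _} {_ ∷ _} (b≤ ∷ _) (y≤z ∷ _) lz = ≤-trans b≤ y≤z ∷ lz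

  cover-splits : ∀ {k a b} {xs ys : Vec (Fin n) k} {lx ly} →
                 (b ∷ ys , ly) ⋖ₖ (a ∷ xs , lx) → b ≡ a ⊎ ys ≡ xs
  cover-splits {a = a} {b} {xs} {ys} {lx} (((b≤a ∷ ys≤xs) , _) , no-between) with ys ≟ᵥ xs | b ≟ a
  ... | yes ys≡xs | _       = inj₂ ys≡xs
  ... | no _      | yes b≡a = inj₁ b≡a
  ... | no ys≢xs  | no b≢a  = ⊥-elim (no-between (b ∷ xs , lower-head b≤a lx)
         (⊏ₖ-intro (≤-refl ∷ ys≤xs) λ e → ys≢xs (cong V.tail e))
         (⊏ₖ-intro (b≤a ∷ Pw.refl ≤-refl) λ e → b≢a (cong V.head e)))

  head-cover : ∀ {k a b} {vs : Vec (Fin n) k} {la lb} → (b ∷ vs , lb) ⋖ₖ (a ∷ vs , la) → b ⋖ₚ a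
  head-cover {vs = vs} {la} (((b≤a ∷ _) , y≢x) , no-between) =
    (b≤a , λ { refl → y≢x (chain-≡ refl) }) ,
    λ z b⊏z z⊏a → no-between (z ∷ vs , lower-head (proj₁ z⊏a) la)
      (⊏ₖ-intro (proj₁ b⊏z ∷ Pw.refl ≤-refl) λ e → proj₂ b⊏z (cong V.head e))
      (⊏ₖ-intro (proj₁ z⊏a ∷ Pw.refl ≤-refl) λ e → proj₂ z⊏a (cong V.head e))

  tail-cover : ∀ {k b} {xs ys : Vec (Fin n) k} {lx ly} →
               (b ∷ ys , ly) ⋖ₖ (b ∷ xs , lx) → (ys , VL.tail ly) ⋖ₖ (xs , VL.tail lx)
  tail-cover {b = b} {ly = ly} (((_ ∷ ys≤xs) , y≢x) , no-between) =
    (ys≤xs , λ e → y≢x (chain-≡ (cong (b ∷_) (cong proj₁ e)))) ,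
    λ z y⊏z z⊏x → no-between (b ∷ proj₁ z , raise-tail ly (proj₁ y⊏z) (proj₂ z))
      (⊏ₖ-intro (≤-refl ∷ proj₁ y⊏z) λ e → proj₂ y⊏z (chain-≡ (cong V.tail e)))
      (⊏ₖ-intro (≤-refl ∷ proj₁ z⊏x) λ e → proj₂ z⊏x (chain-≡ (cong V.tail e)))

  constant : ∀ k → Fin n → Chains le k
  constant k a = replicate k a , linked k
    where
    linked : ∀ k → VL.Linked _≤_ (replicate k a)
    linked zero          = []
    linked (suc zero)    = [-]
    linked (suc (suc k)) = ≤-refl ∷ linked (suc k)

  lastEntry : ∀ {k} → Vec (Fin n) (suc k) → Fin n
  lastEntry (a ∷ [])     = a
  lastEntry (_ ∷ b ∷ vs) = lastEntry (b ∷ vs)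

  constant-below : ∀ {k a c} {vs : Vec (Fin n) k} → a ≤ c → VL.Linked _≤_ (c ∷ vs) →
                   Pointwise _≤_ (replicate (suc k) a) (c ∷ vs)
  constant-below {vs = []}    a≤c _          = a≤c ∷ []
  constant-below {vs = _ ∷ _} a≤c (c≤ ∷ l) = a≤c ∷ constant-below (≤-trans a≤c c≤) l

  constant-above : ∀ {k c t} {vs : Vec (Fin n) k} → lastEntry (c ∷ vs) ≤ t → VL.Linked _≤_ (c ∷ vs) →
                   Pointwise _≤_ (c ∷ vs) (replicate (suc k) t)
  constant-above {vs = []}    last≤t _ = last≤t ∷ []
  constant-above {vs = _ ∷ _} last≤t (c≤ ∷ l) with constant-above last≤t l
  ... | d≤t ∷ rest = ≤-trans c≤ d≤t ∷ d≤t ∷ rest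

  minimal-constant : ∀ {k a} {vs : Vec (Fin n) k} {l} → IsMinimal (≤ₖ le (suc k)) (a ∷ vs , l) →
                     IsMinimal _≤_ a × a ∷ vs ≡ replicate (suc k) a
  minimal-constant {k} {a} {vs} {l} x-min = (λ y y≤a → cong V.head (squeeze y y≤a)) , sym (squeeze a ≤-refl)
    where
    squeeze : ∀ y → y ≤ a → replicate (suc k) y ≡ a ∷ vs
    squeeze y y≤a = cong proj₁ (x-min (constant (suc k) y) (constant-below y≤a l))

  maximal-constant : ∀ {k a} {vs : Vec (Fin n) k} {l} → IsMaximal (≤ₖ le (suc k)) (a ∷ vs , l) →
                     IsMaximal _≤_ (lastEntry (a ∷ vs)) × a ∷ vs ≡ replicate (suc k) (lastEntry (a ∷ vs))
  maximal-constant {k} {a} {vs} {l} x-max =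
    (λ y t≤y → cong V.head (trans (squeeze y t≤y) (sym (squeeze t ≤-refl)))) , sym (squeeze t ≤-refl)
    where
    t = lastEntry (a ∷ vs)
    squeeze : ∀ y → t ≤ y → replicate (suc k) y ≡ a ∷ vs
    squeeze y t≤y = cong proj₁ (x-max (constant (suc k) y) (constant-above t≤y l))

  module _ (ρ : Fin n → ℕ) where

    sumRank-constant : ∀ k (x : Chains le k) c → proj₁ x ≡ replicate k c → sumRank le ρ k x ≡ k * ρ c
    sumRank-constant k _ c refl = sum-replicate k
      where
      sum-replicate : ∀ k → sum (map ρ (replicate k c)) ≡ k * ρ c
      sum-replicate zero    = refl
      sum-replicate (suc k) = cong (ρ c +_) (sum-replicate k)

    sumRank-minimal : IsRankFunction _≤_ ρ → ∀ k x → IsMinimal (≤ₖ le k) x → sumRank le ρ k x ≡ 0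
    sumRank-minimal _           zero    ([] , _)     _     = refl
    sumRank-minimal (ρ-min , _) (suc k) (a ∷ vs , l) x-min with minimal-constant x-min
    ... | a-min , x-constant = begin
      sumRank le ρ (suc k) (a ∷ vs , l) ≡⟨ sumRank-constant (suc k) (a ∷ vs , l) a x-constant ⟩
      suc k * ρ a                       ≡⟨ cong (suc k *_) (ρ-min a a-min) ⟩
      suc k * 0                         ≡⟨ *-zeroʳ (suc k) ⟩
      0                                 ∎
      where open ≡-Reasoning

    sumRank-maximal : ∀ N → (∀ t → IsMaximal _≤_ t → ρ t ≡ N) →
                      ∀ k x → IsMaximal (≤ₖ le k) x → sumRank le ρ k x ≡ k * N
    sumRank-maximal N ρ-max zero    ([] , _)     _     = refl
    sumRank-maximal N ρ-max (suc k) (a ∷ vs , l) x-max with maximal-constant x-max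
    ... | t-max , x-constant = begin
      sumRank le ρ (suc k) (a ∷ vs , l) ≡⟨ sumRank-constant (suc k) (a ∷ vs , l) _ x-constant ⟩
      suc k * ρ (lastEntry (a ∷ vs))    ≡⟨ cong (suc k *_) (ρ-max _ t-max) ⟩
      suc k * N                         ∎
      where open ≡-Reasoning

    -- along a cover of multichains exactly one entry moves up by a cover of P
    sumRank-cover : IsRankFunction _≤_ ρ → ∀ k x y → y ⋖ₖ x → sumRank le ρ k x ≡ suc (sumRank le ρ k y)
    sumRank-cover _  zero    ([] , _)      ([] , _)      ((_ , y≢x) , _) = ⊥-elim (y≢x (chain-≡ refl))
    sumRank-cover rf (suc k) (a ∷ xs , lx) (b ∷ ys , ly) y⋖x with cover-splits y⋖x
    ... | inj₂ refl = cong (_+ sum (map ρ ys)) (proj₂ rf a b (head-cover y⋖x))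
    ... | inj₁ refl = begin
      ρ b + sum (map ρ xs)       ≡⟨ cong (ρ b +_) (sumRank-cover rf k _ _ (tail-cover y⋖x)) ⟩
      ρ b + suc (sum (map ρ ys)) ≡⟨ +-suc (ρ b) _ ⟩
      suc (ρ b + sum (map ρ ys)) ∎
      where open ≡-Reasoning

    sumRank-isRankFunction : IsRankFunction _≤_ ρ → ∀ k → IsRankFunction (≤ₖ le k) (sumRank le ρ k)
    sumRank-isRankFunction rf k = sumRank-minimal rf k , sumRank-cover rf k

-- a graded poset is nonempty: otherwise [] would be a maximal chain
graded-inhabited : ∀ {n} (le : Fin n → Fin n → Bool) {N} → IsGradedOfRank (_≤P_ le) N → Fin n
graded-inhabited {zero}  _  graded with graded [] ([] , λ _ _ _ ())
... | ()
graded-inhabited {suc n} _  _      = fzero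

proposition2p2 : (n : ℕ) (le : Fin n → Fin n → Bool)
    → IsPartialOrder _≡_ (_≤P_ le)
    → (N : ℕ) → IsGradedOfRank (_≤P_ le) N
    → (k : ℕ)
    → IsGradedOfRank (≤ₖ le k) (k * N)
      × ((ρ : Fin n → ℕ) → IsRankFunction (_≤P_ le) ρ
           → IsRankFunction (≤ₖ le k) (sumRank le ρ k))
proposition2p2 n le isPO N graded k = multichains-graded , λ r r-rank → sumRank-isRankFunction r r-rank k
  where
  open Multichains le isPO
  open FinitePoset le isPO
  open Graded N graded

  multichains-graded : IsGradedOfRank (≤ₖ le k) (k * N)
  multichains-graded =
    PosetFacts.graded-by-rank (isPartialOrderₖ k) _≟ₖ_
      (constant k (graded-inhabited le graded))
      (sumRank le ρ k) (sumRank-isRankFunction ρ ρ-isRankFunction k)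
      (k * N) (sumRank-maximal ρ N (rank-maximal ρ ρ-isRankFunction) k)
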